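{- For all integers $a$ and $c$ and all positive integers $b$, $$h(a,b,c)=(x_b+y_{a+b+c-1})\cdot h(a-1,b,c)+h(a,b-1,c).$$
   Context: $R$ is the polynomial ring over $\mathbb{Z}$ in $x_1,x_2,\ldots,y_1,y_2,\ldots$; set $x_i=y_i=0$ for integers $i\le0$. For $a,c\in\mathbb{Z}$ and $b\in\mathbb{N}$, $h(a,b,c)=\sum_{(i_1,\ldots,i_a)\in[b]^a,\ i_1\le i_2\le\cdots\le i_a}\prod_{j=1}^a(x_{i_j}+y_{i_j+(j-1)+c})$ with $[b]=\{1,\ldots,b\}$; this is $1$ when $a=0$ and is defined to be $0$ when $a<0$. -}

module Defs where

open import Level using (Level)
open import Algebra.Bundles using (CommutativeRing)
open import Data.Nat as ℕ using (ℕ; zero; suc)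
open import Data.Nat.Properties using (_≤?_)
open import Data.Integer as ℤ using (ℤ; +_; -[1+_])
open import Data.List using (List; []; _∷_; map; concatMap; applyUpTo; filter)
open import Data.List.Relation.Unary.Linked using (linked?)

range1 : ℕ → List ℕ
range1 b = applyUpTo suc b

tuples : ℕ → ℕ → List (List ℕ)
tuples zero    b = [] ∷ []
tuples (suc a) b = concatMap (λ i → map (i ∷_) (tuples a b)) (range1 b)

weaklyIncreasing : ℕ → ℕ → List (List ℕ)
weaklyIncreasing a b = filter (linked? _≤?_) (tuples a b)

module HDef {c ℓ : Level} (R : CommutativeRing c ℓ) where
  open CommutativeRing R

  -- variables indexed by integers; index ≤ 0 gives 0
  -- (f n is the variable with index n, for n ≥ 1; f 0 is ignored)
  var : (ℕ → Carrier) → ℤ → Carrier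
  var f (+ suc n) = f (suc n)
  var f _         = 0#

  module _ (x y : ℕ → Carrier) where
    -- ∏_{j} (x_{i_j} + y_{i_j + (j-1) + c}); argument k holds (j-1)
    term : ℕ → ℤ → List ℕ → Carrier
    term k cc []       = 1#
    term k cc (i ∷ is) =
      (var x (+ i) + var y (+ i ℤ.+ + k ℤ.+ cc)) * term (suc k) cc is

    sumC : List Carrier → Carrier
    sumC []       = 0#
    sumC (r ∷ rs) = r + sumC rs

    hℕ : ℕ → ℕ → ℤ → Carrier
    hℕ a b cc = sumC (map (term 0 cc) (weaklyIncreasing a b))

    -- h(a,b,c); defined as 0 for a < 0
    h : ℤ → ℕ → ℤ → Carrier
    h (+ a)    b cc = hℕ a b cc
    h -[1+ _ ] b cc = 0#

{-# OPTIONS --safe #-}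
-- Sequences i₁ ≤ ⋯ ≤ i_a in [b+1] either end in b+1, which contributes the factor
-- x_{b+1} + y_{a+b+c}, or lie in [b]. As the sequences are built from their first entry,
-- this is proved for the sums hFrom k lo (sequences bounded below by lo whose first entry
-- sits at position k+1) by induction on a, expanding over the first entry.
module Submission where

open import Defs
open import Level using (Level)
open import Algebra.Bundles using (CommutativeRing)
open import Data.Nat as ℕ using (ℕ; zero; suc; _≤_; _<_; _≤ᵇ_; _≤?_; z≤n)
import Data.Nat.Properties as ℕₚ
open import Data.Integer as ℤ using (ℤ; +_)
open import Data.Bool using (Bool; true; false; _∧_; T)
open import Data.Fin using (Fin; toℕ; fromℕ; inject₁)
open import Data.Fin.Properties using (toℕ<n; toℕ-fromℕ; toℕ-inject₁)
open import Data.List using (List; []; _∷_; map; concatMap; applyUpTo; filter; _++_)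
open import Data.List.Properties using (map-∘)
open import Data.List.Relation.Unary.Linked using (linked?)
open import Data.Vec.Functional using (replicate)
open import Function using (_∘_)
open import Relation.Nullary using (¬_; Dec; does; contradiction)
open import Relation.Binary.PropositionalEquality as ≡ using (_≡_)

module Sums {c ℓ : Level} (R : CommutativeRing c ℓ) (x y : ℕ → CommutativeRing.Carrier R) where
  open CommutativeRing R
  open HDef R using (sumC)
  open import Algebra.Properties.Semiring.Sum semiring
    using (sum; sum-syntax; ∑-distrib-+; *-distribˡ-sum; sum-cong-≋; sum-cong-≗; sum-init-last; sum-replicate-zero)
  open import Relation.Binary.Reasoning.Setoid setoid

  sumL : List Carrier → Carrier
  sumL = sumC x y

  ⟦_⟧ : Bool → Carrier
  ⟦ true ⟧  = 1#
  ⟦ false ⟧ = 0#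

  ⟦⟧-∧ : ∀ b d → ⟦ b ∧ d ⟧ ≈ ⟦ b ⟧ * ⟦ d ⟧
  ⟦⟧-∧ true  d = sym (*-identityˡ ⟦ d ⟧)
  ⟦⟧-∧ false d = sym (zeroˡ ⟦ d ⟧)

  ⟦⟧-true : ∀ {b} → T b → ⟦ b ⟧ ≈ 1#
  ⟦⟧-true {true} _ = refl

  ⟦⟧-false : ∀ {b} → ¬ T b → ⟦ b ⟧ ≈ 0#
  ⟦⟧-false {true}  ¬t = contradiction _ ¬t
  ⟦⟧-false {false} _  = refl

  module _ {A : Set} where

    sumL-cong : {g h : A → Carrier} → (∀ l → g l ≈ h l) → ∀ L → sumL (map g L) ≈ sumL (map h L)
    sumL-cong g≈h []      = refl
    sumL-cong g≈h (l ∷ L) = +-cong (g≈h l) (sumL-cong g≈h L)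

    sumL-*ˡ : ∀ u (g : A → Carrier) L → sumL (map (λ l → u * g l) L) ≈ u * sumL (map g L)
    sumL-*ˡ u g []      = sym (zeroʳ u)
    sumL-*ˡ u g (l ∷ L) = trans (+-congˡ (sumL-*ˡ u g L)) (sym (distribˡ u _ _))

    sumL-++ : ∀ (g : A → Carrier) ls ms → sumL (map g (ls ++ ms)) ≈ sumL (map g ls) + sumL (map g ms)
    sumL-++ g []       ms = sym (+-identityˡ _)
    sumL-++ g (l ∷ ls) ms = trans (+-congˡ (sumL-++ g ls ms)) (sym (+-assoc _ _ _))

    sumL-concatMap : ∀ {B : Set} (g : A → Carrier) (F : B → List A) bs →
      sumL (map g (concatMap F bs)) ≈ sumL (map (λ b → sumL (map g (F b))) bs)
    sumL-concatMap g F []       = refl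
    sumL-concatMap g F (b ∷ bs) = trans (sumL-++ g (F b) (concatMap F bs)) (+-congˡ (sumL-concatMap g F bs))

    sumL-filter : ∀ {p} {P : A → Set p} (P? : ∀ l → Dec (P l)) (g : A → Carrier) L →
      sumL (map g (filter P? L)) ≈ sumL (map (λ l → ⟦ does (P? l) ⟧ * g l) L)
    sumL-filter P? g []      = refl
    sumL-filter P? g (l ∷ L) with does (P? l)
    ... | true  = +-cong (sym (*-identityˡ (g l))) (sumL-filter P? g L)
    ... | false = trans (sumL-filter P? g L) (sym (trans (+-congʳ (zeroˡ (g l))) (+-identityˡ _)))

  sumL-applyUpTo : ∀ (g : ℕ → Carrier) f n → sumL (map g (applyUpTo f n)) ≈ ∑[ i < n ] g (f (toℕ i))
  sumL-applyUpTo g f zero    = refl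
  sumL-applyUpTo g f (suc n) = +-congˡ (sumL-applyUpTo g (f ∘ suc) n)

  sum₁ : ℕ → (ℕ → Carrier) → Carrier
  sum₁ n g = ∑[ i < n ] g (suc (toℕ i))

  sumL-range1 : ∀ (g : ℕ → Carrier) n → sumL (map g (range1 n)) ≈ sum₁ n g
  sumL-range1 g = sumL-applyUpTo g suc

  sum₁-cong : ∀ (g h : ℕ → Carrier) n → (∀ {i} → i ≤ n → g i ≈ h i) → sum₁ n g ≈ sum₁ n h
  sum₁-cong g h n g≈h = sum-cong-≋ (λ i → g≈h (toℕ<n i))

  sum₁-zero : ∀ (g : ℕ → Carrier) n → (∀ {i} → i ≤ n → g i ≈ 0#) → sum₁ n g ≈ 0#
  sum₁-zero g n g≈0 = trans (sum-cong-≋ {y = replicate n 0#} (λ i → g≈0 (toℕ<n i))) (sum-replicate-zero n)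

  sum₁-last : ∀ (g : ℕ → Carrier) n → sum₁ (suc n) g ≈ sum₁ n g + g (suc n)
  sum₁-last g n = begin
    sum₁ (suc n) g                                         ≈⟨ sum-init-last {n} (g ∘ suc ∘ toℕ) ⟩
    sum (λ (i : Fin n) → g (suc (toℕ (inject₁ i)))) + g (suc (toℕ (fromℕ n)))
      ≡⟨ ≡.cong₂ _+_ (sum-cong-≗ {n} (≡.cong (g ∘ suc) ∘ toℕ-inject₁)) (≡.cong (g ∘ suc) (toℕ-fromℕ n)) ⟩
    sum₁ n g + g (suc n)                                   ∎

  sum₁-+ : ∀ (g h : ℕ → Carrier) n → sum₁ n (λ i → g i + h i) ≈ sum₁ n g + sum₁ n h
  sum₁-+ g h n = ∑-distrib-+ {n} (g ∘ suc ∘ toℕ) (h ∘ suc ∘ toℕ)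

  sum₁-*ˡ : ∀ u (g : ℕ → Carrier) n → sum₁ n (λ i → u * g i) ≈ u * sum₁ n g
  sum₁-*ˡ u g n = sym (*-distribˡ-sum {n} u (g ∘ suc ∘ toℕ))

module Recurrence {c ℓ : Level} (R : CommutativeRing c ℓ) (x y : ℕ → CommutativeRing.Carrier R) (cc : ℤ) where
  open CommutativeRing R
  open HDef R using (var; term; hℕ)
  open Sums R x y
  open import Algebra.Properties.CommutativeSemigroup *-commutativeSemigroup using (interchange; x∙yz≈y∙xz)
  open import Relation.Binary.Reasoning.Setoid setoid

  factor : ℕ → ℕ → Carrier
  factor i k = var x (+ i) + var y (+ i ℤ.+ + k ℤ.+ cc)

  ordered : List ℕ → Bool
  ordered is = does (linked? _≤?_ is)

  -- k is the shift j - 1 of the y-index belonging to the first entry (h itself starts at k = 0).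
  hFrom : (k lo a b : ℕ) → Carrier
  hFrom k lo a b = sumL (map (λ is → ⟦ ordered (lo ∷ is) ⟧ * term x y k cc is) (tuples a b))

  hℕ≈hFrom : ∀ a b → hℕ x y a b cc ≈ hFrom 0 0 a b
  hℕ≈hFrom a b = trans (sumL-filter (linked? _≤?_) (term x y 0 cc) (tuples a b))
                       (sumL-cong (λ is → *-congʳ (⟦⟧-ordered-0∷ is)) (tuples a b))
    where
    ⟦⟧-ordered-0∷ : ∀ is → ⟦ ordered is ⟧ ≈ ⟦ ordered (0 ∷ is) ⟧
    ⟦⟧-ordered-0∷ []      = refl
    ⟦⟧-ordered-0∷ (_ ∷ _) = refl

  ordered-∷-term : ∀ k lo i is →
    ⟦ ordered (lo ∷ i ∷ is) ⟧ * term x y k cc (i ∷ is)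
      ≈ (⟦ lo ≤ᵇ i ⟧ * factor i k) * (⟦ ordered (i ∷ is) ⟧ * term x y (suc k) cc is)
  ordered-∷-term k lo i is =
    trans (*-congʳ (⟦⟧-∧ (lo ≤ᵇ i) (ordered (i ∷ is)))) (interchange _ _ _ _)

  hFrom-suc : ∀ k lo a b → hFrom k lo (suc a) b ≈ sum₁ b (λ i → (⟦ lo ≤ᵇ i ⟧ * factor i k) * hFrom (suc k) i a b)
  hFrom-suc k lo a b = begin
    hFrom k lo (suc a) b
      ≈⟨ sumL-concatMap summand (λ i → map (i ∷_) (tuples a b)) (range1 b) ⟩
    sumL (map (λ i → sumL (map summand (map (i ∷_) (tuples a b)))) (range1 b))
      ≈⟨ sumL-cong first-entry (range1 b) ⟩
    sumL (map (λ i → (⟦ lo ≤ᵇ i ⟧ * factor i k) * hFrom (suc k) i a b) (range1 b))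
      ≈⟨ sumL-range1 _ b ⟩
    sum₁ b (λ i → (⟦ lo ≤ᵇ i ⟧ * factor i k) * hFrom (suc k) i a b) ∎
    where
    summand : List ℕ → Carrier
    summand is = ⟦ ordered (lo ∷ is) ⟧ * term x y k cc is
    first-entry : ∀ i → sumL (map summand (map (i ∷_) (tuples a b)))
                          ≈ (⟦ lo ≤ᵇ i ⟧ * factor i k) * hFrom (suc k) i a b
    first-entry i = begin
      sumL (map summand (map (i ∷_) (tuples a b)))  ≡⟨ ≡.cong sumL (map-∘ (tuples a b)) ⟨
      sumL (map (summand ∘ (i ∷_)) (tuples a b))    ≈⟨ sumL-cong (ordered-∷-term k lo i) (tuples a b) ⟩
      sumL (map (λ is → (⟦ lo ≤ᵇ i ⟧ * factor i k) * (⟦ ordered (i ∷ is) ⟧ * term x y (suc k) cc is)) (tuples a b))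
                                                    ≈⟨ sumL-*ˡ _ _ (tuples a b) ⟩
      (⟦ lo ≤ᵇ i ⟧ * factor i k) * hFrom (suc k) i a b ∎

  hFrom-vanish : ∀ k lo a b → b < lo → hFrom k lo (suc a) b ≈ 0#
  hFrom-vanish k lo a b b<lo = trans (hFrom-suc k lo a b) (sum₁-zero _ b below-lo)
    where
    below-lo : ∀ {i} → i ≤ b → (⟦ lo ≤ᵇ i ⟧ * factor i k) * hFrom (suc k) i a b ≈ 0#
    below-lo {i} i≤b = begin
      (⟦ lo ≤ᵇ i ⟧ * factor i k) * hFrom (suc k) i a b
        ≈⟨ *-congʳ (*-congʳ (⟦⟧-false (ℕₚ.<⇒≱ (ℕₚ.≤-<-trans i≤b b<lo) ∘ ℕₚ.≤ᵇ⇒≤ lo i))) ⟩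
      (0# * factor i k) * hFrom (suc k) i a b ≈⟨ trans (*-congʳ (zeroˡ _)) (zeroˡ _) ⟩
      0# ∎

  -- In the step, the summand for the first entry b + 1 loses its second term: those sequences
  -- would have to lie in [b] while being bounded below by b + 1.
  hFrom-recurrence : ∀ a k lo b → lo ≤ suc b →
    hFrom k lo (suc a) (suc b) ≈ factor (suc b) (a ℕ.+ k) * hFrom k lo a (suc b) + hFrom k lo (suc a) b
  hFrom-recurrence zero k lo b lo≤1+b = begin
    hFrom k lo 1 (suc b)               ≈⟨ hFrom-suc k lo 0 (suc b) ⟩
    sum₁ (suc b) summand               ≈⟨ sum₁-last summand b ⟩
    sum₁ b summand + summand (suc b)   ≈⟨ +-congˡ (*-congʳ (trans (*-congʳ (⟦⟧-true (ℕₚ.≤⇒≤ᵇ lo≤1+b))) (*-identityˡ _))) ⟩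
    sum₁ b summand + factor (suc b) k * hFrom k lo 0 (suc b) ≈⟨ +-comm _ _ ⟩
    factor (suc b) k * hFrom k lo 0 (suc b) + sum₁ b summand ≈⟨ +-congˡ (hFrom-suc k lo 0 b) ⟨
    factor (suc b) k * hFrom k lo 0 (suc b) + hFrom k lo 1 b ∎
    where
    summand : ℕ → Carrier
    summand i = (⟦ lo ≤ᵇ i ⟧ * factor i k) * hFrom (suc k) i 0 b
  hFrom-recurrence (suc a) k lo b lo≤1+b = begin
    hFrom k lo (suc (suc a)) (suc b)
      ≈⟨ hFrom-suc k lo (suc a) (suc b) ⟩
    sum₁ (suc b) (λ i → weight i * tails i)
      ≈⟨ sum₁-cong (λ i → weight i * tails i) (λ i → weight i * (F * shorter i + lower i)) (suc b)
           (λ {i} i≤1+b → *-congˡ (hFrom-recurrence a (suc k) i b i≤1+b)) ⟩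
    sum₁ (suc b) (λ i → weight i * (F * shorter i + lower i))
      ≈⟨ sum₁-cong _ (λ i → F * (weight i * shorter i) + weight i * lower i) (suc b)
           (λ {i} _ → trans (distribˡ _ _ _) (+-congʳ (x∙yz≈y∙xz (weight i) F _))) ⟩
    sum₁ (suc b) (λ i → F * (weight i * shorter i) + weight i * lower i)
      ≈⟨ sum₁-+ (λ i → F * (weight i * shorter i)) (λ i → weight i * lower i) (suc b) ⟩
    sum₁ (suc b) (λ i → F * (weight i * shorter i)) + sum₁ (suc b) (λ i → weight i * lower i)
      ≈⟨ +-cong (sum₁-*ˡ F (λ i → weight i * shorter i) (suc b)) (sum₁-last (λ i → weight i * lower i) b) ⟩
    F * sum₁ (suc b) (λ i → weight i * shorter i) + (sum₁ b (λ i → weight i * lower i) + weight (suc b) * lower (suc b))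
      ≈⟨ +-cong (*-cong F≡ (hFrom-suc k lo a (suc b))) (+-congˡ (sym last-vanishes)) ⟨
    factor (suc b) (suc a ℕ.+ k) * hFrom k lo (suc a) (suc b) + (sum₁ b (λ i → weight i * lower i) + 0#)
      ≈⟨ +-congˡ (trans (+-identityʳ _) (sym (hFrom-suc k lo (suc a) b))) ⟩
    factor (suc b) (suc a ℕ.+ k) * hFrom k lo (suc a) (suc b) + hFrom k lo (suc (suc a)) b ∎
    where
    weight tails shorter lower : ℕ → Carrier
    weight i  = ⟦ lo ≤ᵇ i ⟧ * factor i k
    tails i   = hFrom (suc k) i (suc a) (suc b)
    shorter i = hFrom (suc k) i a (suc b)
    lower i   = hFrom (suc k) i (suc a) b
    F : Carrier
    F = factor (suc b) (a ℕ.+ suc k)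
    F≡ : factor (suc b) (suc a ℕ.+ k) ≈ F
    F≡ = reflexive (≡.cong (factor (suc b)) (≡.sym (ℕₚ.+-suc a k)))
    last-vanishes : weight (suc b) * lower (suc b) ≈ 0#
    last-vanishes = trans (*-congˡ (hFrom-vanish (suc k) (suc b) a b ℕₚ.≤-refl)) (zeroʳ _)

y-index-shift : ∀ (n b : ℕ) (c : ℤ) → + b ℤ.+ + n ℤ.+ c ≡ + suc n ℤ.+ + b ℤ.+ c ℤ.- + 1
y-index-shift n b c = solve 3 (λ N B C → B :+ N :+ C := (con (+ 1) :+ N) :+ B :+ C :- con (+ 1)) ≡.refl (+ n) (+ b) c
  where
  open import Data.Integer.Solver using (module +-*-Solver)
  open +-*-Solver

lemma7p5 : ∀ {c ℓ : Level} (R : CommutativeRing c ℓ) (x y : ℕ → CommutativeRing.Carrier R)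
    (a cc : ℤ) (b : ℕ) →
    CommutativeRing._≈_ R (HDef.h R x y a (suc b) cc)
      (CommutativeRing._+_ R
        (CommutativeRing._*_ R
          (CommutativeRing._+_ R (HDef.var R x (+ suc b)) (HDef.var R y (a ℤ.+ + suc b ℤ.+ cc ℤ.- + 1)))
          (HDef.h R x y (a ℤ.- + 1) (suc b) cc))
        (HDef.h R x y a b cc))
lemma7p5 R x y ℤ.-[1+ _ ] cc b = sym (trans (+-identityʳ _) (zeroʳ _))
  where open CommutativeRing R
lemma7p5 R x y (+ zero) cc b = sym (trans (+-congʳ (zeroʳ _)) (+-identityˡ _))
  where open CommutativeRing R
lemma7p5 R x y (+ suc n) cc b = begin
    hℕ x y (suc n) (suc b) cc                                          ≈⟨ hℕ≈hFrom (suc n) (suc b) ⟩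
    hFrom 0 0 (suc n) (suc b)                                          ≈⟨ hFrom-recurrence n 0 0 b z≤n ⟩
    factor (suc b) (n ℕ.+ 0) * hFrom 0 0 n (suc b) + hFrom 0 0 (suc n) b
      ≈⟨ +-cong (*-cong (+-congˡ (reflexive (≡.cong (var y) y-index))) (sym (hℕ≈hFrom n (suc b))))
                (sym (hℕ≈hFrom (suc n) b)) ⟩
    (var x (+ suc b) + var y (+ suc n ℤ.+ + suc b ℤ.+ cc ℤ.- + 1)) * hℕ x y n (suc b) cc + hℕ x y (suc n) b cc ∎
  where
  open CommutativeRing R
  open HDef R using (var; hℕ)
  open Recurrence R x y cc
  open import Relation.Binary.Reasoning.Setoid setoid
  y-index : + suc b ℤ.+ + (n ℕ.+ 0) ℤ.+ cc ≡ + suc n ℤ.+ + suc b ℤ.+ cc ℤ.- + 1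
  y-index = ≡.trans (≡.cong (λ m → + suc b ℤ.+ + m ℤ.+ cc) (ℕₚ.+-identityʳ n)) (y-index-shift n (suc b) cc)
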